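{- Let $n\ge 2$ be an integer, $\zeta_n=e^{2\pi\sqrt{ -1}/n}$, and for an integer $s\ge 0$ put $\mathfrak Z_n(\zeta_n;;s)=\sum_{i=1}^{n-1}\frac{1}{(1-\zeta_n^i)^s}$ (so $\mathfrak Z_n(\zeta_n;;0)=n-1$). Then, as an identity of power series in $x$ (expansions at $x=0$), $$\sum_{s=0}^\infty\mathfrak Z_n(\zeta_n;;s)x^s=\frac{n\bigl(1-(1-x)^{n-1}\bigr)}{1-(1-x)^n}.$$ -}

module Defs where

open import Level using (_⊔_) renaming (suc to lsuc)
open import Data.Nat using (ℕ; zero; suc; _∸_; _≤_; _<_)
open import Data.Product using (∃)
open import Relation.Nullary using (¬_)
open import Algebra.Bundles using (CommutativeRing)

record Field c ℓ : Set (lsuc (c ⊔ ℓ)) where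
  field
    commutativeRing : CommutativeRing c ℓ
  open CommutativeRing commutativeRing public
  field
    0≉1     : ¬ (0# ≈ 1#)
    inverse : ∀ x → ¬ (x ≈ 0#) → ∃ λ y → y * x ≈ 1#

module FieldOps {c ℓ} (K : Field c ℓ) where
  open Field K public

  infixr 8 _^_
  _^_ : Carrier → ℕ → Carrier
  x ^ zero  = 1#
  x ^ suc k = x * (x ^ k)

  fromℕ : ℕ → Carrier
  fromℕ zero    = 0#
  fromℕ (suc m) = 1# + fromℕ m

  CharZero : Set ℓ
  CharZero = ∀ m → ¬ (fromℕ (suc m) ≈ 0#)

  PrimitiveRoot : ℕ → Carrier → Set ℓ
  PrimitiveRoot n ζ = (ζ ^ n ≈ 1#) × (∀ k → 1 ≤ k → k < n → ¬ (ζ ^ k ≈ 1#))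
    where open import Data.Product using (_×_)

  ∑< : ℕ → (ℕ → Carrier) → Carrier
  ∑< zero    f = 0#
  ∑< (suc m) f = ∑< m f + f m

  Series : Set c
  Series = ℕ → Carrier

  _≈ₛ_ : Series → Series → Set ℓ
  f ≈ₛ g = ∀ k → f k ≈ g k

  constₛ : Carrier → Series
  constₛ a zero    = a
  constₛ a (suc k) = 0#

  X : Series
  X zero          = 0#
  X (suc zero)    = 1#
  X (suc (suc k)) = 0#

  _-ₛ_ : Series → Series → Series
  (f -ₛ g) k = f k - g k

  _·ₛ_ : Carrier → Series → Series
  (a ·ₛ f) k = a * f k

  _*ₛ_ : Series → Series → Series
  (f *ₛ g) k = ∑< (suc k) (λ j → f j * g (k ∸ j))

  _^ₛ_ : Series → ℕ → Series
  f ^ₛ zero  = constₛ 1#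
  f ^ₛ suc k = f *ₛ (f ^ₛ k)

{-# OPTIONS --safe #-}

-- Work in K[[x]] with y = 1 - x and zᵢ = ζⁱ. As uᵢ = 1/(1 - zᵢ), the series Σₛ uᵢˢ xˢ = 1/(1 - uᵢx) equals
-- (1 - zᵢ)/(y - zᵢ), and y - zᵢ divides yⁿ - zᵢⁿ = yⁿ - 1; so (1 - yⁿ)/(1 - uᵢx) = (zᵢ - 1) Σₐ zᵢᵃ yⁿ⁻¹⁻ᵃ.
-- Summing over all i < n (the term i = 0 vanishes) gives Σₐ (P(a+1) - P(a)) yⁿ⁻¹⁻ᵃ with P(b) = Σᵢ zᵢᵇ,
-- and P(b) = n for b ∈ {0, n}, P(b) = 0 for 0 < b < n; only a = 0 and a = n - 1 survive: n - n yⁿ⁻¹.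
module Submission where

open import Defs

open import Algebra.Bundles using (CommutativeRing)
open import Data.Nat using (ℕ; zero; suc; _∸_; _≤_; _<_; z≤n; s≤s)
open import Data.Nat.Properties using (m<n⇒m<1+n; n<1+n)
open import Data.Product using (_,_)
open import Relation.Nullary using (¬_)

module FiniteSum {c ℓ} (R : CommutativeRing c ℓ) where
  open CommutativeRing R
  open import Relation.Binary.Reasoning.Setoid setoid
  open import Algebra.Properties.AbelianGroup +-abelianGroup using (⁻¹-∙-comm)
  open import Algebra.Properties.CommutativeSemigroup +-commutativeSemigroup using (interchange)

  sum< : ℕ → (ℕ → Carrier) → Carrier
  sum< zero    f = 0#
  sum< (suc m) f = sum< m f + f m

  sum<-cong : ∀ m {f g} → (∀ i → i < m → f i ≈ g i) → sum< m f ≈ sum< m g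
  sum<-cong zero    f≈g = refl
  sum<-cong (suc m) f≈g =
    +-cong (sum<-cong m (λ i i<m → f≈g i (m<n⇒m<1+n i<m))) (f≈g m (n<1+n m))

  sum<-zero : ∀ m {f} → (∀ i → i < m → f i ≈ 0#) → sum< m f ≈ 0#
  sum<-zero m f≈0 = trans (sum<-cong m f≈0) (vanish m)
    where
    vanish : ∀ m → sum< m (λ _ → 0#) ≈ 0#
    vanish zero    = refl
    vanish (suc m) = trans (+-identityʳ _) (vanish m)

  sum<-head : ∀ m f → sum< (suc m) f ≈ f 0 + sum< m (λ i → f (suc i))
  sum<-head zero    f = +-comm 0# (f 0)
  sum<-head (suc m) f = trans (+-congʳ (sum<-head m f)) (+-assoc _ _ _)

  sum<-distrib-+ : ∀ m f g → sum< m (λ i → f i + g i) ≈ sum< m f + sum< m g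
  sum<-distrib-+ zero    f g = sym (+-identityʳ 0#)
  sum<-distrib-+ (suc m) f g = trans (+-congʳ (sum<-distrib-+ m f g)) (interchange _ _ _ _)

  sum<-distrib-sub : ∀ m f g → sum< m (λ i → f i - g i) ≈ sum< m f - sum< m g
  sum<-distrib-sub zero    f g = sym (-‿inverseʳ 0#)
  sum<-distrib-sub (suc m) f g = begin
    sum< m (λ i → f i - g i) + (f m - g m)     ≈⟨ +-congʳ (sum<-distrib-sub m f g) ⟩
    (sum< m f - sum< m g) + (f m - g m)       ≈⟨ interchange _ _ _ _ ⟩
    (sum< m f + f m) + (- sum< m g + - g m)   ≈⟨ +-congˡ (⁻¹-∙-comm _ _) ⟩
    (sum< m f + f m) - (sum< m g + g m)       ∎

  *-distribˡ-sum< : ∀ m x f → x * sum< m f ≈ sum< m (λ i → x * f i)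
  *-distribˡ-sum< zero    x f = zeroʳ x
  *-distribˡ-sum< (suc m) x f = trans (distribˡ x _ _) (+-congʳ (*-distribˡ-sum< m x f))

  *-distribʳ-sum< : ∀ m x f → sum< m f * x ≈ sum< m (λ i → f i * x)
  *-distribʳ-sum< zero    x f = zeroˡ x
  *-distribʳ-sum< (suc m) x f = trans (distribʳ x _ _) (+-congʳ (*-distribʳ-sum< m x f))

  sum<-comm : ∀ m p (F : ℕ → ℕ → Carrier) →
              sum< m (λ i → sum< p (F i)) ≈ sum< p (λ j → sum< m (λ i → F i j))
  sum<-comm zero    p F = sym (sum<-zero p (λ _ _ → refl))
  sum<-comm (suc m) p F = trans (+-congʳ (sum<-comm m p F)) (sym (sum<-distrib-+ p _ _))

  sum<-reverse : ∀ m f → sum< m f ≈ sum< m (λ i → f (m ∸ suc i))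
  sum<-reverse zero    f = refl
  sum<-reverse (suc m) f = begin
    sum< m f + f m                                ≈⟨ +-congʳ (sum<-reverse m f) ⟩
    sum< m (λ i → f (m ∸ suc i)) + f m            ≈⟨ +-comm _ _ ⟩
    f m + sum< m (λ i → f (m ∸ suc i))            ≈⟨ sum<-head m (λ i → f (m ∸ i)) ⟨
    sum< (suc m) (λ i → f (m ∸ i))                ∎

  sum<-triangle : ∀ k (F : ℕ → ℕ → Carrier) →
    sum< (suc k) (λ j → sum< (suc j) (λ i → F i (j ∸ i))) ≈ sum< (suc k) (λ i → sum< (suc (k ∸ i)) (F i))
  sum<-triangle zero    F = refl
  sum<-triangle (suc k) F = begin
    sum< (suc (suc k)) (λ j → sum< (suc j) (λ i → F i (j ∸ i)))
      ≈⟨ sum<-cong (suc (suc k)) (λ j _ → sum<-head j (λ i → F i (j ∸ i))) ⟩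
    sum< (suc (suc k)) (λ j → F 0 j + sum< j (λ i → F (suc i) (j ∸ suc i)))
      ≈⟨ sum<-distrib-+ (suc (suc k)) _ _ ⟩
    sum< (suc (suc k)) (F 0) + sum< (suc (suc k)) (λ j → sum< j (λ i → F (suc i) (j ∸ suc i)))
      ≈⟨ +-congˡ (trans (sum<-head (suc k) _) (+-identityˡ _)) ⟩
    sum< (suc (suc k)) (F 0) + sum< (suc k) (λ j → sum< (suc j) (λ i → F (suc i) (j ∸ i)))
      ≈⟨ +-congˡ (sum<-triangle k (λ i → F (suc i))) ⟩
    sum< (suc (suc k)) (F 0) + sum< (suc k) (λ i → sum< (suc (k ∸ i)) (F (suc i)))
      ≈⟨ sum<-head (suc k) _ ⟨
    sum< (suc (suc k)) (λ i → sum< (suc (suc k ∸ i)) (F i)) ∎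

  sum<-endpoints : ∀ m f → (∀ i → i < m → f (suc i) ≈ 0#) → sum< (suc (suc m)) f ≈ f 0 + f (suc m)
  sum<-endpoints m f inner≈0 =
    +-congʳ (trans (sum<-head m f) (trans (+-congˡ (sum<-zero m inner≈0)) (+-identityʳ (f 0))))

module Powers {c ℓ} (R : CommutativeRing c ℓ) where
  open CommutativeRing R
  open FiniteSum R
  open import Relation.Binary.Reasoning.Setoid setoid
  open import Algebra.Properties.Semiring.Exp semiring public using (_^_)
  open import Algebra.Properties.Semiring.Exp semiring using (^-congˡ; ^-assocʳ)
  open import Algebra.Properties.Ring ring using (x[y-z]≈xy-xz; [y-z]x≈yx-zx; -‿distribˡ-*)
  open import Algebra.Properties.AbelianGroup +-abelianGroup using (⁻¹-anti-homo‿-)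
  open import Algebra.Properties.CommutativeSemigroup *-commutativeSemigroup using (x∙yz≈y∙xz; xy∙z≈xz∙y)
  open import Relation.Binary.PropositionalEquality using (cong)
  import Data.Nat.Properties as ℕ

  ^-zeroˡ : ∀ n → 1# ^ n ≈ 1#
  ^-zeroˡ zero    = refl
  ^-zeroˡ (suc n) = trans (*-identityˡ _) (^-zeroˡ n)

  ^-comm : ∀ x m n → (x ^ m) ^ n ≈ (x ^ n) ^ m
  ^-comm x m n = trans (^-assocʳ x m n) (trans (reflexive (cong (x ^_) (ℕ.*-comm m n))) (sym (^-assocʳ x n m)))

  ^-root-of-unity : ∀ {ζ} n i → ζ ^ n ≈ 1# → (ζ ^ i) ^ n ≈ 1#
  ^-root-of-unity {ζ} n i ζⁿ≈1 = trans (^-comm ζ i n) (trans (^-congˡ i ζⁿ≈1) (^-zeroˡ i))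

  difference-of-powers : ∀ n y z → (y - z) * sum< n (λ a → z ^ a * y ^ (n ∸ suc a)) ≈ y ^ n - z ^ n
  difference-of-powers zero    y z = trans (zeroʳ _) (sym (-‿inverseʳ 1#))
  difference-of-powers (suc n) y z = begin
    (y - z) * sum< (suc n) (λ a → z ^ a * y ^ (n ∸ a))
      ≈⟨ *-congˡ (sum<-head n _) ⟩
    (y - z) * (1# * y ^ n + sum< n (λ a → z * z ^ a * y ^ (n ∸ suc a)))
      ≈⟨ *-congˡ (+-cong (*-identityˡ _) (trans (sum<-cong n (λ a _ → *-assoc _ _ _)) (sym (*-distribˡ-sum< n z _)))) ⟩
    (y - z) * (y ^ n + z * t)
      ≈⟨ distribˡ _ _ _ ⟩
    (y - z) * y ^ n + (y - z) * (z * t)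
      ≈⟨ +-congˡ (trans (x∙yz≈y∙xz _ _ _) (*-congˡ (difference-of-powers n y z))) ⟩
    (y - z) * y ^ n + z * (y ^ n - z ^ n)
      ≈⟨ +-cong ([y-z]x≈yx-zx _ _ _) (x[y-z]≈xy-xz _ _ _) ⟩
    (y * y ^ n - z * y ^ n) + (z * y ^ n - z * z ^ n)
      ≈⟨ telescope _ _ _ ⟩
    y * y ^ n - z * z ^ n ∎
    where
    t : Carrier
    t = sum< n (λ a → z ^ a * y ^ (n ∸ suc a))

    telescope : ∀ a b c → (a - b) + (b - c) ≈ a - c
    telescope a b c = begin
      (a - b) + (b - c)     ≈⟨ +-assoc _ _ _ ⟩
      a + (- b + (b - c))   ≈⟨ +-congˡ (+-assoc _ _ _) ⟨
      a + ((- b + b) - c)   ≈⟨ +-congˡ (+-congʳ (-‿inverseˡ b)) ⟩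
      a + (0# - c)          ≈⟨ +-congˡ (+-identityˡ _) ⟩
      a - c                 ∎

  cancel-linear-factor : ∀ n {w x z g} → w * (1# - z) ≈ 1# → (1# - w * x) * g ≈ 1# → z ^ n ≈ 1# →
    (1# - (1# - x) ^ n) * g ≈ (z - 1#) * sum< n (λ a → z ^ a * (1# - x) ^ (n ∸ suc a))
  cancel-linear-factor n {w} {x} {z} {g} w[1-z]≈1 [1-wx]g≈1 zⁿ≈1 = begin
    (1# - y ^ n) * g               ≈⟨ *-congʳ (+-congʳ zⁿ≈1) ⟨
    (z ^ n - y ^ n) * g            ≈⟨ *-congʳ (⁻¹-anti-homo‿- (y ^ n) (z ^ n)) ⟨
    (- (y ^ n - z ^ n)) * g        ≈⟨ *-congʳ (-‿cong (difference-of-powers n y z)) ⟨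
    (- ((y - z) * t)) * g          ≈⟨ *-congʳ (-‿distribˡ-* _ _) ⟩
    (- (y - z) * t) * g            ≈⟨ xy∙z≈xz∙y _ _ _ ⟩
    (- (y - z) * g) * t            ≈⟨ *-congʳ (trans (sym (-‿distribˡ-* _ _)) (-‿cong [y-z]g≈1-z)) ⟩
    (- (1# - z)) * t               ≈⟨ *-congʳ (⁻¹-anti-homo‿- 1# z) ⟩
    (z - 1#) * t                   ∎
    where
    y t : Carrier
    y = 1# - x
    t = sum< n (λ a → z ^ a * y ^ (n ∸ suc a))

    w[y-z]≈1-wx : w * (y - z) ≈ 1# - w * x
    w[y-z]≈1-wx = begin
      w * ((1# - x) - z)   ≈⟨ *-congˡ (trans (+-assoc 1# _ _) (trans (+-congˡ (+-comm _ _)) (sym (+-assoc 1# _ _)))) ⟩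
      w * ((1# - z) - x)   ≈⟨ x[y-z]≈xy-xz w _ x ⟩
      w * (1# - z) - w * x ≈⟨ +-congʳ w[1-z]≈1 ⟩
      1# - w * x           ∎
    [y-z]g≈1-z : (y - z) * g ≈ 1# - z
    [y-z]g≈1-z = begin
      (y - z) * g                     ≈⟨ *-identityˡ _ ⟨
      1# * ((y - z) * g)              ≈⟨ *-congʳ (trans (*-comm _ _) w[1-z]≈1) ⟨
      ((1# - z) * w) * ((y - z) * g)  ≈⟨ *-assoc _ _ _ ⟩
      (1# - z) * (w * ((y - z) * g))  ≈⟨ *-congˡ (trans (sym (*-assoc _ _ _)) (*-congʳ w[y-z]≈1-wx)) ⟩
      (1# - z) * ((1# - w * x) * g)   ≈⟨ *-congˡ [1-wx]g≈1 ⟩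
      (1# - z) * 1#                   ≈⟨ *-identityʳ _ ⟩
      1# - z                          ∎

module PowerSeries {c ℓ} (R : CommutativeRing c ℓ) where
  open CommutativeRing R
  open FiniteSum R
  open Powers R using (_^_)
  import Relation.Binary.Reasoning.Setoid as Reasoning
  open import Relation.Binary.PropositionalEquality using (cong) renaming (sym to ≡-sym)
  open import Data.Nat.Properties using (≤-pred; m+[n∸m]≡n; ∸-+-assoc; m∸[m∸n]≡n)
  open import Algebra.Properties.Ring ring using (-0#≈0#)
  import Data.Nat as ℕ
  import Algebra.Construct.Pointwise ℕ as Pointwise

  infix  4 _≋_
  infixl 7 _⋆_

  _≋_ : (ℕ → Carrier) → (ℕ → Carrier) → Set ℓ
  f ≋ g = ∀ k → f k ≈ g k

  _⋆_ : (ℕ → Carrier) → (ℕ → Carrier) → ℕ → Carrier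
  (f ⋆ g) k = sum< (suc k) (λ j → f j * g (k ∸ j))

  C : Carrier → ℕ → Carrier
  C a zero    = a
  C a (suc k) = 0#

  X : ℕ → Carrier
  X 1 = 1#
  X _ = 0#

  geometric : Carrier → ℕ → Carrier
  geometric a k = a ^ k

  ⋆-cong : ∀ {f f′ g g′} → f ≋ f′ → g ≋ g′ → f ⋆ g ≋ f′ ⋆ g′
  ⋆-cong f≋f′ g≋g′ k = sum<-cong (suc k) (λ j _ → *-cong (f≋f′ j) (g≋g′ (k ∸ j)))

  ⋆-comm : ∀ f g → f ⋆ g ≋ g ⋆ f
  ⋆-comm f g k = trans (sum<-reverse (suc k) _) (sum<-cong (suc k) λ j j≤k →
    trans (*-comm _ _) (*-congʳ (reflexive (cong g (m∸[m∸n]≡n (≤-pred j≤k))))))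

  C⋆-coeff : ∀ a f k → (C a ⋆ f) k ≈ a * f k
  C⋆-coeff a f k = begin
    (C a ⋆ f) k                                    ≈⟨ sum<-head k _ ⟩
    a * f k + sum< k (λ j → 0# * f (k ∸ suc j))    ≈⟨ +-congˡ (sum<-zero k (λ j _ → zeroˡ _)) ⟩
    a * f k + 0#                                   ≈⟨ +-identityʳ _ ⟩
    a * f k                                        ∎
    where open Reasoning setoid

  ⋆-identityˡ : ∀ f → C 1# ⋆ f ≋ f
  ⋆-identityˡ f k = trans (C⋆-coeff 1# f k) (*-identityˡ (f k))

  ⋆-identityʳ : ∀ f → f ⋆ C 1# ≋ f
  ⋆-identityʳ f k = trans (⋆-comm f (C 1#) k) (⋆-identityˡ f k)

  ⋆-distribˡ : ∀ f g h → f ⋆ (λ k → g k + h k) ≋ λ k → (f ⋆ g) k + (f ⋆ h) k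
  ⋆-distribˡ f g h k = trans (sum<-cong (suc k) (λ j _ → distribˡ _ _ _)) (sum<-distrib-+ (suc k) _ _)

  ⋆-distribʳ : ∀ f g h → (λ k → g k + h k) ⋆ f ≋ λ k → (g ⋆ f) k + (h ⋆ f) k
  ⋆-distribʳ f g h k = trans (sum<-cong (suc k) (λ j _ → distribʳ _ _ _)) (sum<-distrib-+ (suc k) _ _)

  ⋆-assoc : ∀ f g h → (f ⋆ g) ⋆ h ≋ f ⋆ (g ⋆ h)
  ⋆-assoc f g h k = begin
    sum< (suc k) (λ j → sum< (suc j) (λ i → f i * g (j ∸ i)) * h (k ∸ j))
      ≈⟨ sum<-cong (suc k) (λ j _ → trans (*-distribʳ-sum< (suc j) _ _) (sum<-cong (suc j) λ i i≤j →
           *-congˡ (reflexive (cong (λ l → h (k ∸ l)) (≡-sym (m+[n∸m]≡n (≤-pred i≤j))))))) ⟩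
    sum< (suc k) (λ j → sum< (suc j) (λ i → F i (j ∸ i)))
      ≈⟨ sum<-triangle k F ⟩
    sum< (suc k) (λ i → sum< (suc (k ∸ i)) (F i))
      ≈⟨ sum<-cong (suc k) (λ i _ → trans (sum<-cong (suc (k ∸ i)) λ l _ →
           trans (*-assoc _ _ _) (*-congˡ (*-congˡ (reflexive (cong h (≡-sym (∸-+-assoc k i l)))))))
           (sym (*-distribˡ-sum< (suc (k ∸ i)) _ _))) ⟩
    sum< (suc k) (λ i → f i * sum< (suc (k ∸ i)) (λ l → g l * h (k ∸ i ∸ l)))
      ∎
    where
    open Reasoning setoid
    F : ℕ → ℕ → Carrier
    F i l = f i * g l * h (k ∸ (i ℕ.+ l))

  seriesRing : CommutativeRing c ℓ
  seriesRing = record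
    { Carrier = ℕ → Carrier
    ; _≈_ = _≋_
    ; _+_ = λ f g k → f k + g k
    ; _*_ = _⋆_
    ; -_ = λ f k → - f k
    ; 0# = λ _ → 0#
    ; 1# = C 1#
    ; isCommutativeRing = record
      { isRing = record
        { +-isAbelianGroup = Pointwise.isAbelianGroup +-isAbelianGroup
        ; *-cong = ⋆-cong
        ; *-assoc = ⋆-assoc
        ; *-identity = ⋆-identityˡ , ⋆-identityʳ
        ; distrib = ⋆-distribˡ , ⋆-distribʳ
        }
      ; *-comm = ⋆-comm
      }
    }

  module S where
    open CommutativeRing seriesRing public
    open FiniteSum seriesRing public
    open Powers seriesRing public

  module ≋-Reasoning = Reasoning S.setoid

  C-cong : ∀ {a b} → a ≈ b → C a S.≈ C b
  C-cong a≈b zero    = a≈b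
  C-cong a≈b (suc k) = refl

  C-+ : ∀ a b → C (a + b) S.≈ C a S.+ C b
  C-+ a b zero    = refl
  C-+ a b (suc k) = sym (+-identityʳ 0#)

  C-neg : ∀ a → C (- a) S.≈ S.- C a
  C-neg a zero    = refl
  C-neg a (suc k) = sym -0#≈0#

  C-sub : ∀ a b → C (a - b) S.≈ C a S.- C b
  C-sub a b k = trans (C-+ a (- b) k) (+-congˡ (C-neg b k))

  C-zero : C 0# S.≈ S.0#
  C-zero zero    = refl
  C-zero (suc k) = refl

  C-* : ∀ a b → C (a * b) S.≈ C a S.* C b
  C-* a b zero    = sym (C⋆-coeff a (C b) 0)
  C-* a b (suc k) = sym (trans (C⋆-coeff a (C b) (suc k)) (zeroʳ a))

  C-^ : ∀ a n → C (a ^ n) S.≈ C a S.^ n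
  C-^ a zero    = S.refl
  C-^ a (suc n) = S.trans (C-* a (a ^ n)) (S.*-congˡ (C-^ a n))

  C-sum< : ∀ m F → C (sum< m F) S.≈ S.sum< m (λ i → C (F i))
  C-sum< zero    F zero    = refl
  C-sum< zero    F (suc k) = refl
  C-sum< (suc m) F = S.trans (C-+ (sum< m F) (F m)) (S.+-congʳ (C-sum< m F))

  sum<-coeff : ∀ m F k → S.sum< m F k ≈ sum< m (λ i → F i k)
  sum<-coeff zero    F k = refl
  sum<-coeff (suc m) F k = +-congʳ (sum<-coeff m F k)

  sum<-C⋆-comm : ∀ m p (d : ℕ → ℕ → Carrier) (h : ℕ → ℕ → Carrier) →
    S.sum< m (λ i → S.sum< p (λ a → C (d i a) ⋆ h a))
      S.≈ S.sum< p (λ a → C (sum< m (λ i → d i a)) ⋆ h a)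
  sum<-C⋆-comm m p d h = begin
    S.sum< m (λ i → S.sum< p (λ a → C (d i a) ⋆ h a))
      ≈⟨ S.sum<-comm m p (λ i a → C (d i a) ⋆ h a) ⟩
    S.sum< p (λ a → S.sum< m (λ i → C (d i a) ⋆ h a))
      ≈⟨ S.sum<-cong p (λ a _ → S.*-distribʳ-sum< m (h a) (λ i → C (d i a))) ⟨
    S.sum< p (λ a → S.sum< m (λ i → C (d i a)) ⋆ h a)
      ≈⟨ S.sum<-cong p (λ a _ → S.*-congʳ {h a} (C-sum< m (λ i → d i a))) ⟨
    S.sum< p (λ a → C (sum< m (λ i → d i a)) ⋆ h a)
      ∎
    where open ≋-Reasoning

  X⋆-zero : ∀ f → (X ⋆ f) 0 ≈ 0#
  X⋆-zero f = trans (+-identityˡ _) (zeroˡ (f 0))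

  X⋆-suc : ∀ f k → (X ⋆ f) (suc k) ≈ f k
  X⋆-suc f k = begin
    (X ⋆ f) (suc k)
      ≈⟨ sum<-head (suc k) _ ⟩
    0# * f (suc k) + sum< (suc k) (λ j → X (suc j) * f (k ∸ j))
      ≈⟨ trans (+-congʳ (zeroˡ _)) (+-identityˡ _) ⟩
    sum< (suc k) (λ j → X (suc j) * f (k ∸ j))
      ≈⟨ sum<-head k _ ⟩
    1# * f k + sum< k (λ j → 0# * f (k ∸ suc j))
      ≈⟨ +-cong (*-identityˡ _) (sum<-zero k (λ j _ → zeroˡ _)) ⟩
    f k + 0#
      ≈⟨ +-identityʳ _ ⟩
    f k
      ∎
    where open Reasoning setoid

  geometric-inverse : ∀ a → (S.1# S.- C a S.* X) S.* geometric a S.≈ S.1#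
  geometric-inverse a = begin
    (S.1# S.- C a S.* X) S.* geometric a
      ≈⟨ [y-z]x≈yx-zx (geometric a) S.1# (C a S.* X) ⟩
    S.1# S.* geometric a S.- C a S.* X S.* geometric a
      ≈⟨ S.+-cong (S.*-identityˡ (geometric a)) (S.-‿cong (S.*-assoc (C a) X (geometric a))) ⟩
    geometric a S.- C a S.* (X S.* geometric a)
      ≈⟨ coeff ⟩
    S.1#
      ∎
    where
    open ≋-Reasoning
    open import Algebra.Properties.Ring S.ring using ([y-z]x≈yx-zx)
    coeff : geometric a S.- C a S.* (X S.* geometric a) S.≈ S.1#
    coeff zero    = trans (+-congˡ (-‿cong (trans (C⋆-coeff a (X ⋆ geometric a) 0)
                                                 (trans (*-congˡ (X⋆-zero (geometric a))) (zeroʳ a)))))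
                          (trans (+-congˡ -0#≈0#) (+-identityʳ 1#))
    coeff (suc k) = trans (+-congˡ (-‿cong (trans (C⋆-coeff a (X ⋆ geometric a) (suc k))
                                                 (*-congˡ (X⋆-suc (geometric a) k)))))
                          (-‿inverseʳ (a * a ^ k))

module RootsOfUnity {c ℓ} (K : Field c ℓ) where
  open Field K
  open FiniteSum commutativeRing
  open Powers commutativeRing
  open import Relation.Binary.Reasoning.Setoid setoid
  open import Algebra.Properties.Group +-group using (x∙y⁻¹≈ε⇒x≈y)

  x*y≈0⇒y≈0 : ∀ {x y} → ¬ x ≈ 0# → x * y ≈ 0# → y ≈ 0#
  x*y≈0⇒y≈0 {x} {y} x≉0 xy≈0 with inverse x x≉0
  ... | x⁻¹ , x⁻¹x≈1 = begin
    y               ≈⟨ *-identityˡ y ⟨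
    1# * y          ≈⟨ *-congʳ x⁻¹x≈1 ⟨
    (x⁻¹ * x) * y   ≈⟨ *-assoc x⁻¹ x y ⟩
    x⁻¹ * (x * y)   ≈⟨ *-congˡ xy≈0 ⟩
    x⁻¹ * 0#        ≈⟨ zeroʳ x⁻¹ ⟩
    0#              ∎

  sum<-^-root-of-unity : ∀ n b {ζ} → ζ ^ n ≈ 1# → ¬ ζ ^ b ≈ 1# → sum< n (λ i → (ζ ^ i) ^ b) ≈ 0#
  sum<-^-root-of-unity n b {ζ} ζⁿ≈1 ζᵇ≉1 = x*y≈0⇒y≈0 1-ζᵇ≉0 (begin
    (1# - r) * sum< n (λ i → (ζ ^ i) ^ b)
      ≈⟨ *-congˡ (sum<-cong n (λ i _ → ^-comm ζ i b)) ⟩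
    (1# - r) * sum< n (λ i → r ^ i)
      ≈⟨ *-congˡ (sum<-cong n (λ i _ → trans (*-congˡ (^-zeroˡ (n ∸ suc i))) (*-identityʳ _))) ⟨
    (1# - r) * sum< n (λ i → r ^ i * 1# ^ (n ∸ suc i))
      ≈⟨ difference-of-powers n 1# r ⟩
    1# ^ n - r ^ n
      ≈⟨ +-cong (^-zeroˡ n) (-‿cong (^-root-of-unity n b ζⁿ≈1)) ⟩
    1# - 1#
      ≈⟨ -‿inverseʳ 1# ⟩
    0#
      ∎)
    where
    r : Carrier
    r = ζ ^ b

    1-ζᵇ≉0 : ¬ 1# - r ≈ 0#
    1-ζᵇ≉0 1-r≈0 = ζᵇ≉1 (sym (x∙y⁻¹≈ε⇒x≈y 1# r 1-r≈0))

module GeneratingFunction {c ℓ} (K : Field c ℓ) where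
  open Field K
  open FiniteSum commutativeRing
  open Powers commutativeRing
  open RootsOfUnity K
  open PowerSeries commutativeRing
  open ≋-Reasoning
  open import Data.Nat.Properties using (m≤n⇒m≤1+n; ≤-refl; n∸n≡0)
  open import Relation.Binary.PropositionalEquality using (cong)
  open import Algebra.Properties.Ring ring using (-0#≈0#; [y-z]x≈yx-zx)
  open import Algebra.Properties.Ring S.ring using ()
    renaming (-‿distribˡ-* to ⋆-‿distribˡ; x[y-z]≈xy-xz to ⋆-x[y-z]≈xy-xz)

  module _ (m : ℕ) {ζ : Carrier} (ζⁿ≈1 : ζ ^ suc (suc m) ≈ 1#)
           (ζᵇ≉1 : ∀ b → 1 ≤ b → b < suc (suc m) → ¬ ζ ^ b ≈ 1#) where

    n : ℕ
    n = suc (suc m)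

    Y : ℕ → Carrier
    Y = S.1# S.- X

    N : Carrier
    N = sum< n (λ _ → 1#)

    power-sum : ℕ → Carrier
    power-sum b = sum< n (λ i → (ζ ^ i) ^ b)

    power-sum-n : power-sum n ≈ N
    power-sum-n = sum<-cong n (λ i _ → ^-root-of-unity n i ζⁿ≈1)

    power-sum-mid : ∀ b → 1 ≤ b → b < n → power-sum b ≈ 0#
    power-sum-mid b 1≤b b<n = sum<-^-root-of-unity n b ζⁿ≈1 (ζᵇ≉1 b 1≤b b<n)

    jump : ℕ → Carrier
    jump a = power-sum (suc a) - power-sum a

    jump-first : jump 0 ≈ - N
    jump-first = trans (+-congʳ (power-sum-mid 1 (s≤s z≤n) (s≤s (s≤s z≤n)))) (+-identityˡ (- N))

    jump-mid : ∀ a → a < m → jump (suc a) ≈ 0#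
    jump-mid a a<m = trans (+-cong (power-sum-mid (suc (suc a)) (s≤s z≤n) (s≤s (s≤s a<m)))
                                   (-‿cong (power-sum-mid (suc a) (s≤s z≤n) (s≤s (m≤n⇒m≤1+n a<m)))))
                           (-‿inverseʳ 0#)

    jump-last : jump (suc m) ≈ N
    jump-last = trans (+-cong power-sum-n (-‿cong (power-sum-mid (suc m) (s≤s z≤n) (s≤s ≤-refl))))
                      (trans (+-congˡ -0#≈0#) (+-identityʳ N))

    T : Carrier → ℕ → Carrier
    T z = S.sum< n (λ a → C z S.^ a S.* Y S.^ (n ∸ suc a))

    root-identity : ∀ i {u} → u * (1# - ζ ^ i) ≈ 1# →
      (S.1# S.- Y S.^ n) S.* geometric u S.≈ (C (ζ ^ i) S.- S.1#) S.* T (ζ ^ i)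
    root-identity i {u} u[1-ζⁱ]≈1 =
      S.cancel-linear-factor n {C u} {X} {C (ζ ^ i)} {geometric u} Cu[1-Cζⁱ]≈1 (geometric-inverse u) [Cζⁱ]ⁿ≈1
      where
      Cu[1-Cζⁱ]≈1 : C u S.* (S.1# S.- C (ζ ^ i)) S.≈ S.1#
      Cu[1-Cζⁱ]≈1 = S.trans (S.*-congˡ {C u} (S.sym (C-sub 1# (ζ ^ i))))
                            (S.trans (S.sym (C-* u (1# - ζ ^ i))) (C-cong u[1-ζⁱ]≈1))
      [Cζⁱ]ⁿ≈1 : C (ζ ^ i) S.^ n S.≈ S.1#
      [Cζⁱ]ⁿ≈1 = S.trans (S.sym (C-^ (ζ ^ i) n)) (C-cong (^-root-of-unity n i ζⁿ≈1))

    root-term : ∀ z →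
      (C z S.- S.1#) S.* T z S.≈ S.sum< n (λ a → C ((z - 1#) * z ^ a) S.* Y S.^ (n ∸ suc a))
    root-term z = begin
      (C z S.- S.1#) S.* T z
        ≈⟨ S.*-distribˡ-sum< n (C z S.- S.1#) (λ a → C z S.^ a S.* Y S.^ (n ∸ suc a)) ⟩
      S.sum< n (λ a → (C z S.- S.1#) S.* (C z S.^ a S.* Y S.^ (n ∸ suc a)))
        ≈⟨ S.sum<-cong n (λ a _ → S.*-assoc (C z S.- S.1#) (C z S.^ a) (Y S.^ (n ∸ suc a))) ⟨
      S.sum< n (λ a → ((C z S.- S.1#) S.* C z S.^ a) S.* Y S.^ (n ∸ suc a))
        ≈⟨ S.sum<-cong n (λ a _ → S.*-congʳ {Y S.^ (n ∸ suc a)} (C-factor a)) ⟩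
      S.sum< n (λ a → C ((z - 1#) * z ^ a) S.* Y S.^ (n ∸ suc a)) ∎
      where
      C-factor : ∀ a → (C z S.- S.1#) S.* C z S.^ a S.≈ C ((z - 1#) * z ^ a)
      C-factor a = S.sym (S.trans (C-* (z - 1#) (z ^ a)) (S.*-cong (C-sub z 1#) (C-^ z a)))

    jump-as-sum : ∀ a → sum< n (λ i → (ζ ^ i - 1#) * (ζ ^ i) ^ a) ≈ jump a
    jump-as-sum a = trans (sum<-cong n λ i _ → trans ([y-z]x≈yx-zx _ _ _) (+-congˡ (-‿cong (*-identityˡ _))))
                          (sum<-distrib-sub n _ _)

    sum-of-root-terms :
      S.sum< n (λ i → (C (ζ ^ i) S.- S.1#) S.* T (ζ ^ i)) S.≈ C N S.* (S.1# S.- Y S.^ suc m)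
    sum-of-root-terms = begin
      S.sum< n (λ i → (C (ζ ^ i) S.- S.1#) S.* T (ζ ^ i))
        ≈⟨ S.sum<-cong n (λ i _ → root-term (ζ ^ i)) ⟩
      S.sum< n (λ i → S.sum< n (λ a → C ((ζ ^ i - 1#) * (ζ ^ i) ^ a) S.* Y S.^ (n ∸ suc a)))
        ≈⟨ sum<-C⋆-comm n n (λ i a → (ζ ^ i - 1#) * (ζ ^ i) ^ a) (λ a → Y S.^ (n ∸ suc a)) ⟩
      S.sum< n (λ a → C (sum< n (λ i → (ζ ^ i - 1#) * (ζ ^ i) ^ a)) S.* Y S.^ (n ∸ suc a))
        ≈⟨ S.sum<-cong n (λ a _ → S.*-congʳ {Y S.^ (n ∸ suc a)} (C-cong (jump-as-sum a))) ⟩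
      S.sum< n (λ a → C (jump a) S.* Y S.^ (n ∸ suc a))
        ≈⟨ S.sum<-endpoints m _ (λ a a<m →
             S.trans (S.*-congʳ {Y S.^ (m ∸ a)} (S.trans (C-cong (jump-mid a a<m)) C-zero)) (S.zeroˡ (Y S.^ (m ∸ a)))) ⟩
      C (jump 0) S.* Y S.^ suc m S.+ C (jump (suc m)) S.* Y S.^ (m ∸ m)
        ≈⟨ S.+-cong (S.*-congʳ {Y S.^ suc m} (S.trans (C-cong jump-first) (C-neg N)))
                    (S.*-cong (C-cong jump-last) (S.reflexive (cong (Y S.^_) (n∸n≡0 m)))) ⟩
      S.- C N S.* Y S.^ suc m S.+ C N S.* S.1#
        ≈⟨ S.+-comm _ _ ⟩
      C N S.* S.1# S.+ S.- C N S.* Y S.^ suc m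
        ≈⟨ S.+-congˡ {C N S.* S.1#} (⋆-‿distribˡ (C N) (Y S.^ suc m)) ⟨
      C N S.* S.1# S.- C N S.* Y S.^ suc m
        ≈⟨ ⋆-x[y-z]≈xy-xz (C N) S.1# (Y S.^ suc m) ⟨
      C N S.* (S.1# S.- Y S.^ suc m) ∎

    generating-function : (u : ℕ → Carrier) → (∀ i → 1 ≤ i → i < n → u i * (1# - ζ ^ i) ≈ 1#) →
      (S.1# S.- Y S.^ n) S.* S.sum< (suc m) (λ j → geometric (u (suc j))) S.≈ C N S.* (S.1# S.- Y S.^ suc m)
    generating-function u u[1-ζⁱ]≈1 = begin
      (S.1# S.- Y S.^ n) S.* S.sum< (suc m) (λ j → geometric (u (suc j)))
        ≈⟨ S.*-distribˡ-sum< (suc m) (S.1# S.- Y S.^ n) _ ⟩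
      S.sum< (suc m) (λ j → (S.1# S.- Y S.^ n) S.* geometric (u (suc j)))
        ≈⟨ S.sum<-cong (suc m) (λ j j<m → root-identity (suc j) (u[1-ζⁱ]≈1 (suc j) (s≤s z≤n) (s≤s j<m))) ⟩
      S.sum< (suc m) (λ j → Q (suc j))
        ≈⟨ S.+-identityˡ _ ⟨
      S.0# S.+ S.sum< (suc m) (λ j → Q (suc j))
        ≈⟨ S.+-congʳ (S.trans (S.*-congʳ {T 1#} (S.-‿inverseʳ S.1#)) (S.zeroˡ (T 1#))) ⟨
      Q 0 S.+ S.sum< (suc m) (λ j → Q (suc j))
        ≈⟨ S.sum<-head (suc m) Q ⟨
      S.sum< n Q
        ≈⟨ sum-of-root-terms ⟩
      C N S.* (S.1# S.- Y S.^ suc m) ∎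
      where
      Q : ℕ → ℕ → Carrier
      Q i = (C (ζ ^ i) S.- S.1#) S.* T (ζ ^ i)

module FieldOpsAgreement {c ℓ} (K : Field c ℓ) where
  open FieldOps K using (Carrier; _≈_; _≈ₛ_; 1#; refl; trans; sym; +-cong; +-congʳ; +-comm; *-congˡ; -‿cong;
                         ∑<; fromℕ; constₛ; _-ₛ_; _·ₛ_; _*ₛ_; _^ₛ_)
                    renaming (_^_ to _^ᴷ_; X to Xᴷ)
  open FiniteSum (Field.commutativeRing K)
  open Powers (Field.commutativeRing K)
  open PowerSeries (Field.commutativeRing K)

  ^ᴷ≈^ : ∀ x k → x ^ᴷ k ≈ x ^ k
  ^ᴷ≈^ x zero    = refl
  ^ᴷ≈^ x (suc k) = *-congˡ (^ᴷ≈^ x k)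

  ∑<≈sum< : ∀ m f → ∑< m f ≈ sum< m f
  ∑<≈sum< zero    f = refl
  ∑<≈sum< (suc m) f = +-congʳ (∑<≈sum< m f)

  fromℕ≈sum<-1 : ∀ m → fromℕ m ≈ sum< m (λ _ → 1#)
  fromℕ≈sum<-1 zero    = refl
  fromℕ≈sum<-1 (suc m) = trans (+-comm 1# (fromℕ m)) (+-congʳ (fromℕ≈sum<-1 m))

  constₛ≋C : ∀ a → constₛ a ≈ₛ C a
  constₛ≋C a zero    = refl
  constₛ≋C a (suc k) = refl

  Xᴷ≋X : Xᴷ ≈ₛ X
  Xᴷ≋X zero          = refl
  Xᴷ≋X (suc zero)    = refl
  Xᴷ≋X (suc (suc k)) = refl

  -ₛ-cong : ∀ {f f′ g g′} → f ≈ₛ f′ → g ≈ₛ g′ → (f -ₛ g) ≈ₛ (f′ S.- g′)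
  -ₛ-cong f≋f′ g≋g′ k = +-cong (f≋f′ k) (-‿cong (g≋g′ k))

  *ₛ≋⋆ : ∀ f g → (f *ₛ g) ≈ₛ (f ⋆ g)
  *ₛ≋⋆ f g k = ∑<≈sum< (suc k) _

  ^ₛ≋^ : ∀ {f g} → f ≈ₛ g → ∀ k → (f ^ₛ k) ≈ₛ (g S.^ k)
  ^ₛ≋^ f≋g zero    = constₛ≋C 1#
  ^ₛ≋^ {f} f≋g (suc k) = S.trans (*ₛ≋⋆ f (f ^ₛ k)) (⋆-cong f≋g (^ₛ≋^ f≋g k))

  ·ₛ≋C⋆ : ∀ a f → (a ·ₛ f) ≈ₛ (C a ⋆ f)
  ·ₛ≋C⋆ a f k = sym (C⋆-coeff a f k)

  1-X≋Y : (constₛ 1# -ₛ Xᴷ) ≈ₛ (S.1# S.- X)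
  1-X≋Y = -ₛ-cong (constₛ≋C 1#) Xᴷ≋X

  lhs-agreement : ∀ n m (v : ℕ → Carrier) →
    ((constₛ 1# -ₛ ((constₛ 1# -ₛ Xᴷ) ^ₛ n)) *ₛ (λ s → ∑< m (λ j → v j ^ᴷ s)))
      ≈ₛ ((S.1# S.- (S.1# S.- X) S.^ n) ⋆ S.sum< m (λ j → geometric (v j)))
  lhs-agreement n m v =
    S.trans (*ₛ≋⋆ _ (λ s → ∑< m (λ j → v j ^ᴷ s))) (⋆-cong (-ₛ-cong (constₛ≋C 1#) (^ₛ≋^ 1-X≋Y n)) λ s →
      trans (∑<≈sum< m _)
            (trans (sum<-cong m (λ j _ → ^ᴷ≈^ (v j) s)) (sym (sum<-coeff m (λ j → geometric (v j)) s))))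

  rhs-agreement : ∀ n k →
    (fromℕ n ·ₛ (constₛ 1# -ₛ ((constₛ 1# -ₛ Xᴷ) ^ₛ k)))
      ≈ₛ (C (sum< n (λ _ → 1#)) ⋆ (S.1# S.- (S.1# S.- X) S.^ k))
  rhs-agreement n k = S.trans (·ₛ≋C⋆ (fromℕ n) _) (⋆-cong (C-cong (fromℕ≈sum<-1 n))
                                                           (-ₛ-cong (constₛ≋C 1#) (^ₛ≋^ 1-X≋Y k)))

lemma2 : ∀ {c ℓ} (K : Field c ℓ) → let open FieldOps K in
    CharZero →
    (n : ℕ) → 2 ≤ n →
    (ζ : Carrier) → PrimitiveRoot n ζ →
    (u : ℕ → Carrier) → (∀ i → 1 ≤ i → i < n → u i * (1# - ζ ^ i) ≈ 1#) →
    ((constₛ 1# -ₛ ((constₛ 1# -ₛ X) ^ₛ n)) *ₛ (λ s → ∑< (n ∸ 1) (λ j → u (suc j) ^ s)))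
      ≈ₛ (fromℕ n ·ₛ (constₛ 1# -ₛ ((constₛ 1# -ₛ X) ^ₛ (n ∸ 1))))
lemma2 K _ n@(suc (suc m)) (s≤s (s≤s z≤n)) ζ (ζⁿ≈1 , ζᵇ≉1) u u[1-ζⁱ]≈1 =
  S.trans (lhs-agreement n (suc m) (λ j → u (suc j)))
    (S.trans (generating-function m ζⁿ≈1′ ζᵇ≉1′ u u[1-ζⁱ]≈1′) (S.sym (rhs-agreement n (suc m))))
  where
  open Field K
  open Powers commutativeRing using (_^_)
  open PowerSeries commutativeRing using (module S)
  open FieldOpsAgreement K using (^ᴷ≈^; lhs-agreement; rhs-agreement)
  open GeneratingFunction K using (generating-function)

  ζⁿ≈1′ : ζ ^ n ≈ 1#
  ζⁿ≈1′ = trans (sym (^ᴷ≈^ ζ n)) ζⁿ≈1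

  ζᵇ≉1′ : ∀ b → 1 ≤ b → b < n → ¬ ζ ^ b ≈ 1#
  ζᵇ≉1′ b 1≤b b<n ζᵇ≈1 = ζᵇ≉1 b 1≤b b<n (trans (^ᴷ≈^ ζ b) ζᵇ≈1)

  u[1-ζⁱ]≈1′ : ∀ i → 1 ≤ i → i < n → u i * (1# - ζ ^ i) ≈ 1#
  u[1-ζⁱ]≈1′ i 1≤i i<n = trans (*-congˡ (+-congˡ (-‿cong (sym (^ᴷ≈^ ζ i))))) (u[1-ζⁱ]≈1 i 1≤i i<n)
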